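{- For a finite item set $U$ and a weight limit $W>0$, \[\sum_{i\in U}\bigl(\mathrm{fopt}(U,W)-\mathrm{fopt}(U\setminus\{i\},W)\bigr)\le \mathrm{fopt}(U,W).\]
   Context: Each item $i$ has a positive weight $w(i)$ and a nonnegative value $v(i)$. For a finite item set $U$ and $W>0$, $\mathrm{fopt}(U,W)$ is the optimal value of the fractional knapsack problem: maximize $\sum_{i\in U}v(i)x(i)$ subject to $\sum_{i\in U}w(i)x(i)\le W$ and $0\le x(i)\le 1$ for all $i\in U$.
   Formalization: The weights $w(i)$, the values $v(i)$, the weight limit $W$ and the fractional solutions x are all rational rather than real. -}

module Defs where

open import Data.Nat using (ℕ)
open import Data.Fin using (Fin; zero; suc)
open import Data.Fin.Subset using (Subset; _∈_)
open import Data.Vec using (lookup)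
open import Data.Bool using (if_then_else_)
open import Data.Rational using (ℚ; 0ℚ; 1ℚ; _+_; _*_; _≤_)
open import Data.Product using (Σ; _×_)
open import Relation.Binary.PropositionalEquality using (_≡_)

sumFin : {n : ℕ} → (Fin n → ℚ) → ℚ
sumFin {ℕ.zero}  f = 0ℚ
sumFin {ℕ.suc n} f = f zero + sumFin (λ j → f (suc j))

sumOver : {n : ℕ} → Subset n → (Fin n → ℚ) → ℚ
sumOver S f = sumFin (λ j → if lookup S j then f j else 0ℚ)

Feasible : {n : ℕ} → (w : Fin n → ℚ) → Subset n → ℚ → (Fin n → ℚ) → Set
Feasible w S W x =
  ((j : _) → j ∈ S → (0ℚ ≤ x j) × (x j ≤ 1ℚ)) × (sumOver S (λ j → w j * x j) ≤ W)

IsFopt : {n : ℕ} → (w v : Fin n → ℚ) → Subset n → ℚ → ℚ → Set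
IsFopt w v S W z =
  (Σ (_ → ℚ) (λ x → Feasible w S W x × (sumOver S (λ j → v j * x j) ≡ z)))
  × ((x : _ → ℚ) → Feasible w S W x → sumOver S (λ j → v j * x j) ≤ z)

-- Let x be an optimal fractional solution for U. Removing an item i from U
-- keeps x feasible (the weight can only drop) and loses exactly v i * x i of
-- its value, so fopt(U - i) ≥ z - v i * x i. Summing these marginal bounds over
-- i ∈ U gives Σ (z - fopt(U - i)) ≤ Σ v i * x i = z.
module Submission where

open import Defs
open import Data.Nat using (ℕ)
open import Data.Fin using (Fin)
open import Data.Fin.Subset using (Subset; _∈_; _-_)
open import Data.Rational using (ℚ; 0ℚ; _≤_; _<_; _-_)

open import Data.Bool using (true; false; if_then_else_)
open import Data.Fin using (zero; suc)
open import Data.Fin.Subset.Properties using (p─⊥≡p; p─q⊆p)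
open import Data.Product using (_,_; proj₁)
open import Data.Rational using (_+_; _*_; nonNegative)
open import Data.Rational.Properties
open import Data.Vec using (_∷_; []; here; there)
import Algebra.Bundles
open import Algebra.Properties.Group +-0-group using (//-rightDividesʳ)
open import Algebra.Properties.CommutativeSemigroup
  (Algebra.Bundles.CommutativeMonoid.commutativeSemigroup +-0-commutativeMonoid)
  using (x∙yz≈y∙xz)
open import Function using (_∘_)
open import Relation.Binary.PropositionalEquality using (_≡_; cong; sym; module ≡-Reasoning)

private
  variable
    n : ℕ
    S : Subset n
    i : Fin n
    W : ℚ

p≡q+r∧r≤s⇒p-s≤q : ∀ {p q r s} → p ≡ q + r → r ≤ s → p Data.Rational.- s ≤ q
p≡q+r∧r≤s⇒p-s≤q {p} {q} {r} {s} p≡q+r r≤s = begin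
  p Data.Rational.- s       ≤⟨ +-monoʳ-≤ p (neg-antimono-≤ r≤s) ⟩
  p Data.Rational.- r       ≡⟨ cong (Data.Rational._- r) p≡q+r ⟩
  (q + r) Data.Rational.- r ≡⟨ //-rightDividesʳ r q ⟩
  q ∎
  where open ≤-Reasoning

p≤q+p : ∀ {p q} → 0ℚ ≤ q → p ≤ q + p
p≤q+p {p} 0≤q = ≤-trans (≤-reflexive (sym (+-identityˡ p))) (+-monoˡ-≤ p 0≤q)

nonNeg*nonNeg : ∀ {p q} → 0ℚ ≤ p → 0ℚ ≤ q → 0ℚ ≤ p * q
nonNeg*nonNeg {p} {q} 0≤p 0≤q =
  nonNegative⁻¹ _ {{nonNeg*nonNeg⇒nonNeg p {{nonNegative 0≤p}} q {{nonNegative 0≤q}}}}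

sumOver-remove : (f : Fin n → ℚ) → i ∈ S →
  sumOver S f ≡ f i + sumOver (S Data.Fin.Subset.- i) f
sumOver-remove {S = true ∷ S} f here = cong (f zero +_) (begin
  sumOver S f′                            ≡⟨ cong (λ T → sumOver T f′) (sym (p─⊥≡p S)) ⟩
  sumOver (S Data.Fin.Subset.─ _) f′      ≡⟨ sym (+-identityˡ _) ⟩
  0ℚ + sumOver (S Data.Fin.Subset.─ _) f′ ∎)
  where
  open ≡-Reasoning
  f′ : Fin _ → ℚ
  f′ j = f (suc j)
sumOver-remove {S = b ∷ S} f (there {i = i} i∈S) = begin
  f₀ + sumOver S f′                                ≡⟨ cong (f₀ +_) (sumOver-remove f′ i∈S) ⟩
  f₀ + (f′ i + sumOver (S Data.Fin.Subset.- i) f′) ≡⟨ x∙yz≈y∙xz f₀ (f′ i) _ ⟩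
  f′ i + (f₀ + sumOver (S Data.Fin.Subset.- i) f′) ∎
  where
  open ≡-Reasoning
  f′ : Fin _ → ℚ
  f′ j = f (suc j)
  f₀ : ℚ
  f₀ = if b then f zero else 0ℚ

sumOver-mono : {f g : Fin n → ℚ} → (∀ j → j ∈ S → f j ≤ g j) → sumOver S f ≤ sumOver S g
sumOver-mono {S = []}        f≤g = ≤-refl
sumOver-mono {S = true ∷ S}  f≤g = +-mono-≤ (f≤g zero here) (sumOver-mono (λ j → f≤g (suc j) ∘ there))
sumOver-mono {S = false ∷ S} f≤g = +-monoʳ-≤ 0ℚ (sumOver-mono (λ j → f≤g (suc j) ∘ there))

Feasible-remove : {w x : Fin n → ℚ} → 0ℚ ≤ w i → i ∈ S →
  Feasible w S W x → Feasible w (S Data.Fin.Subset.- i) W x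
Feasible-remove {i = i} {S = S} {W = W} {w = w} {x = x} 0≤wᵢ i∈S (x-bounds , weight≤W) =
  (λ j j∈S-i → x-bounds j (p─q⊆p S _ j∈S-i)) , (begin
    sumOver (S Data.Fin.Subset.- i) wx        ≤⟨ p≤q+p (nonNeg*nonNeg 0≤wᵢ (proj₁ (x-bounds i i∈S))) ⟩
    wx i + sumOver (S Data.Fin.Subset.- i) wx ≡⟨ sym (sumOver-remove wx i∈S) ⟩
    sumOver S wx                              ≤⟨ weight≤W ⟩
    W                                         ∎)
  where
  open ≤-Reasoning
  wx : Fin _ → ℚ
  wx j = w j * x j

loss-on-removal≤contribution : {w v x : Fin n → ℚ} {z′ : ℚ} →
  0ℚ ≤ w i → i ∈ S → Feasible w S W x → IsFopt w v (S Data.Fin.Subset.- i) W z′ →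
  sumOver S (λ j → v j * x j) Data.Rational.- z′ ≤ v i * x i
loss-on-removal≤contribution {w = w} {v} {x} 0≤wᵢ i∈S x-feasible (_ , fopt-bound) =
  p≡q+r∧r≤s⇒p-s≤q (sumOver-remove (λ j → v j * x j) i∈S)
                  (fopt-bound x (Feasible-remove {w = w} 0≤wᵢ i∈S x-feasible))

lemma2p4 : (n : ℕ) (w v : Fin n → ℚ) → (∀ i → 0ℚ < w i) → (∀ i → 0ℚ ≤ v i)
    → (U : Subset n) (W : ℚ) → 0ℚ < W
    → (z : ℚ) → IsFopt w v U W z
    → (zs : Fin n → ℚ) → (∀ i → i ∈ U → IsFopt w v (U Data.Fin.Subset.- i) W (zs i))
    → sumOver U (λ i → z Data.Rational.- zs i) ≤ z
lemma2p4 n w v 0<w _ U W _ z ((x , x-feasible , value≡z) , _) zs zs-fopt = begin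
  sumOver U (λ i → z Data.Rational.- zs i)     ≡⟨ cong (λ t → sumOver U (λ i → t Data.Rational.- zs i)) (sym value≡z) ⟩
  sumOver U (λ i → value Data.Rational.- zs i) ≤⟨ sumOver-mono loss≤contribution ⟩
  value                                        ≡⟨ value≡z ⟩
  z ∎
  where
  open ≤-Reasoning
  value : ℚ
  value = sumOver U (λ j → v j * x j)
  loss≤contribution : ∀ i → i ∈ U → value Data.Rational.- zs i ≤ v i * x i
  loss≤contribution i i∈U =
    loss-on-removal≤contribution {w = w} {v} (<⇒≤ (0<w i)) i∈U x-feasible (zs-fopt i i∈U)
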